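{- Let $k\geq 3$. There is no $k$-geodetic digraph with minimum out-degree at least $2$ and order $M(2,k)+2$ (where $M(2,k)=1+2+\dots+2^k$) whose in-degree sequence is $(1,2,\dots,2,3)$, i.e. exactly one vertex has in-degree $1$, exactly one has in-degree $3$, and all others have in-degree $2$.
   Context: A digraph is $k$-geodetic if for any two vertices $u,v$ there is at most one directed walk from $u$ to $v$ of length at most $k$. The in-degree sequence is the list of in-degrees of the vertices in non-decreasing order. -}

module Defs where

open import Data.Nat using (ℕ; zero; suc; _+_; _^_; _≤_)
open import Data.Bool using (Bool; true; false; T; if_then_else_)
open import Data.Fin using (Fin)
open import Data.List using (List; map; allFin)
open import Data.Nat.ListAction using (sum)
open import Data.Product using (Σ; _×_)
open import Relation.Binary.PropositionalEquality using (_≡_; subst)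
open import Relation.Nullary using (¬_)

Digraph : ℕ → Set
Digraph n = Fin n → Fin n → Bool

module _ {n : ℕ} (G : Digraph n) where

  data Walk : Fin n → Fin n → ℕ → Set where
    [] : ∀ {u} → Walk u u 0
    _∷_ : ∀ {u v w ℓ} → T (G u v) → Walk v w ℓ → Walk u w (suc ℓ)

  KGeodetic : ℕ → Set
  KGeodetic k = ∀ (u v : Fin n) (ℓ m : ℕ) (p : Walk u v ℓ) (q : Walk u v m) →
    ℓ ≤ k → m ≤ k → Σ (ℓ ≡ m) (λ eq → subst (Walk u v) eq p ≡ q)

  outdeg : Fin n → ℕ
  outdeg u = sum (map (λ v → if G u v then 1 else 0) (allFin n))

  indeg : Fin n → ℕ
  indeg v = sum (map (λ u → if G u v then 1 else 0) (allFin n))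

  MinOutDegAtLeast : ℕ → Set
  MinOutDegAtLeast d = ∀ u → d ≤ outdeg u

  InDegSeq1-2-3 : Set
  InDegSeq1-2-3 = Σ (Fin n) λ a → Σ (Fin n) λ b →
    indeg a ≡ 1 × indeg b ≡ 3 ×
    (∀ v → ¬ v ≡ a → ¬ v ≡ b → indeg v ≡ 2)

M : ℕ → ℕ → ℕ
M d zero = 1
M d (suc k) = M d k + d ^ suc k

module Submission where

-- Idea of the proof.
--
-- Let C j u v be the number of walks u → v of length ≤ j and
-- t j v = ∑ᵤ C j u v the number of walks of length ≤ j ending at v.
-- Splitting off the first arc gives C (j+1) u v = [u = v] + ∑ₓ [u → x] C j x v,
-- hence  t (j+1) v = 1 + ∑ₓ indeg(x) · C j x v.
-- In a k-geodetic digraph C j u v ≤ 1 for j ≤ k (two walks would give two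
-- distinct walks of length ≤ k), so t k v ≤ n.  For the in-degree sequence
-- (1,2,…,2,3), with a the vertex of in-degree 1 and b that of in-degree 3,
-- weighting by in-degrees gives t (j+1) b ≥ 1 + 2 · t j b (the deficit at a is
-- paid for by the walk of length 0 at b) and t 1 b ≥ 4, so
-- t k b + 1 ≥ 5 · 2^(k-1).  But n = M(2,k) + 2 = 2^(k+1) + 1 = 4 · 2^(k-1) + 1,
-- which is too small as soon as k ≥ 3.

open import Defs
open import Data.Nat using (ℕ; _+_; _≤_)
open import Data.Empty using (⊥)

open import Data.Nat using (zero; suc; _*_; _^_; z≤n; s≤s; _≤?_)
open import Data.Nat.Properties hiding (_≟_; suc-injective)
open import Data.Nat.Solver using (module +-*-Solver)
open import Data.Nat.ListAction using () renaming (sum to listSum)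
open import Data.Bool using (Bool; true; false; T; if_then_else_)
open import Data.Unit using (tt)
open import Data.Fin using (Fin; zero; suc)
open import Data.Fin.Properties using (_≟_; suc-injective)
open import Data.List using (List; []; _∷_; map; allFin; tabulate)
open import Data.List.Properties using (map-tabulate; ∷-injectiveˡ; ∷-injectiveʳ)
open import Data.Product using (Σ; _×_; _,_)
open import Data.Sum using (_⊎_; inj₁; inj₂)
open import Function using (_∘_)
open import Relation.Binary.PropositionalEquality
open import Relation.Nullary using (¬_; does; yes; no; contradiction)
open import Algebra.Properties.Semiring.Sum +-*-semiring
  using (sum; sum-syntax; sum-cong-≗; sum-replicate-zero; ∑-distrib-+; ∑-comm;
         *-distribˡ-sum; *-distribʳ-sum)
open import Algebra.Properties.CommutativeSemigroup +-commutativeSemigroup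
  using () renaming (xy∙z≈xz∙y to +-right-comm)

δ : ∀ {n} → Fin n → Fin n → ℕ
δ x y = if does (x ≟ y) then 1 else 0

δ-refl : ∀ {n} (x : Fin n) → δ x x ≡ 1
δ-refl x with x ≟ x
... | yes _ = refl
... | no x≢x = contradiction refl x≢x

δ-≢ : ∀ {n} {x y : Fin n} → ¬ x ≡ y → δ x y ≡ 0
δ-≢ {x = x} {y} x≢y with x ≟ y
... | yes x≡y = contradiction x≡y x≢y
... | no _ = refl

δ≤1 : ∀ {n} (x y : Fin n) → δ x y ≤ 1
δ≤1 x y with does (x ≟ y)
... | true = ≤-refl
... | false = z≤n

∑-δ : ∀ {n} (a : Fin n) (f : Fin n → ℕ) → ∑[ x < n ] (δ x a * f x) ≡ f a
∑-δ {suc n} zero f = begin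
  1 * f zero + ∑[ x < n ] 0 ≡⟨ cong (1 * f zero +_) (sum-replicate-zero n) ⟩
  1 * f zero + 0            ≡⟨ +-identityʳ _ ⟩
  1 * f zero                ≡⟨ *-identityˡ _ ⟩
  f zero                    ∎
  where open ≡-Reasoning
∑-δ (suc a) f = ∑-δ a (f ∘ suc)

∑-δ-one : ∀ {n} (a : Fin n) → ∑[ x < n ] δ x a ≡ 1
∑-δ-one {n} a = trans (sum-cong-≗ (λ x → sym (*-identityʳ (δ x a)))) (∑-δ a (λ _ → 1))

∑-mono-≤ : ∀ {n} {f g : Fin n → ℕ} → (∀ x → f x ≤ g x) → sum f ≤ sum g
∑-mono-≤ {zero} f≤g = z≤n
∑-mono-≤ {suc n} f≤g = +-mono-≤ (f≤g zero) (∑-mono-≤ (f≤g ∘ suc))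

term≤∑ : ∀ {n} (f : Fin n → ℕ) y → f y ≤ sum f
term≤∑ f zero = m≤m+n (f zero) _
term≤∑ f (suc y) = ≤-trans (term≤∑ (f ∘ suc) y) (m≤n+m _ (f zero))

∑-one : ∀ n → ∑[ x < n ] 1 ≡ n
∑-one zero = refl
∑-one (suc n) = cong suc (∑-one n)

∑-positive : ∀ {n} (f : Fin n → ℕ) → 1 ≤ sum f → Σ (Fin n) λ x → 1 ≤ f x
∑-positive {suc n} f h with f zero in eq
... | suc _ = zero , subst (1 ≤_) (sym eq) (s≤s z≤n)
... | zero with ∑-positive (f ∘ suc) h
...   | x , fx≥1 = suc x , fx≥1

TwoSplit : ∀ {n} → (Fin n → ℕ) → Set
TwoSplit {n} f = (Σ (Fin n) λ x → 2 ≤ f x) ⊎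
  (Σ (Fin n) λ x → Σ (Fin n) λ y → ¬ x ≡ y × 1 ≤ f x × 1 ≤ f y)

∑-two : ∀ {n} (f : Fin n → ℕ) → 2 ≤ sum f → TwoSplit f
∑-two {suc n} f h with f zero in eq
... | suc (suc _) = inj₁ (zero , subst (2 ≤_) (sym eq) (s≤s (s≤s z≤n)))
... | suc zero with ∑-positive (f ∘ suc) (≤-pred h)
...   | y , fy≥1 = inj₂ (zero , suc y , (λ ()) , subst (1 ≤_) (sym eq) ≤-refl , fy≥1)
∑-two {suc n} f h | zero with ∑-two (f ∘ suc) h
... | inj₁ (x , fx≥2) = inj₁ (suc x , fx≥2)
... | inj₂ (x , y , x≢y , fx≥1 , fy≥1) =
  inj₂ (suc x , suc y , x≢y ∘ suc-injective , fx≥1 , fy≥1)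

listSum-allFin : ∀ {n} (f : Fin n → ℕ) → listSum (map f (allFin n)) ≡ sum f
listSum-allFin {n} f = trans (cong listSum (map-tabulate (λ x → x) f)) (tabulated f)
  where
  tabulated : ∀ {m} (g : Fin m → ℕ) → listSum (tabulate g) ≡ sum g
  tabulated {zero} g = refl
  tabulated {suc m} g = cong (g zero +_) (tabulated (g ∘ suc))

indicator-product : ∀ (b : Bool) {m} c → suc m ≤ (if b then 1 else 0) * c → T b × suc m ≤ c
indicator-product true c h = tt , subst (_ ≤_) (+-identityʳ c) h

-- Walk counts in a digraph

module WalkCounts {n : ℕ} (G : Digraph n) where

  arc : Fin n → Fin n → ℕ
  arc u x = if G u x then 1 else 0

  inDegree : Fin n → ℕ
  inDegree x = ∑[ u < n ] arc u x

  inDegree-≡ : ∀ x → indeg G x ≡ inDegree x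
  inDegree-≡ x = listSum-allFin (λ u → arc u x)

  -- C j u v is the number of walks u → v of length ≤ j, by the first arc.
  C : ℕ → Fin n → Fin n → ℕ
  C zero u v = δ u v
  C (suc j) u v = δ u v + ∑[ x < n ] (arc u x * C j x v)

  C-refl : ∀ j v → 1 ≤ C j v v
  C-refl zero v = ≤-reflexive (sym (δ-refl v))
  C-refl (suc j) v = ≤-trans (≤-reflexive (sym (δ-refl v))) (m≤m+n _ _)

  C-≢ : ∀ j {u v} → ¬ u ≡ v → C (suc j) u v ≡ ∑[ x < n ] (arc u x * C j x v)
  C-≢ j {u} {v} u≢v = cong (_+ ∑[ x < n ] (arc u x * C j x v)) (δ-≢ u≢v)

  ShortWalk : ℕ → Fin n → Fin n → Set
  ShortWalk j u v = Σ ℕ λ ℓ → ℓ ≤ j × Walk G u v ℓ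

  vertices : ∀ {u v ℓ} → Walk G u v ℓ → List (Fin n)
  vertices [] = []
  vertices (_∷_ {v = x} _ p) = x ∷ vertices p

  trace : ∀ {j u v} → ShortWalk j u v → List (Fin n)
  trace (_ , _ , p) = vertices p

  stay : ∀ {j u} → ShortWalk j u u
  stay = 0 , z≤n , []

  _◃_ : ∀ {j u x v} → T (G u x) → ShortWalk j x v → ShortWalk (suc j) u v
  e ◃ (ℓ , ℓ≤j , p) = suc ℓ , s≤s ℓ≤j , e ∷ p

  DistinctPair : ℕ → Fin n → Fin n → Set
  DistinctPair j u v = Σ (ShortWalk j u v) λ p → Σ (ShortWalk j u v) λ q → ¬ trace p ≡ trace q

  ArcThenWalk : ℕ → Fin n → Fin n → Set
  ArcThenWalk j u v = Σ (Fin n) λ x → T (G u x) × ShortWalk j x v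

  walk-of-count : ∀ j u v → 1 ≤ C j u v → ShortWalk j u v
  arc-of-count : ∀ j u v → 1 ≤ ∑[ x < n ] (arc u x * C j x v) → ArcThenWalk j u v

  arc-of-count j u v h with ∑-positive _ h
  ... | x , hx with indicator-product (G u x) (C j x v) hx
  ...   | e , cx≥1 = x , e , walk-of-count j x v cx≥1

  walk-of-count j u v h with u ≟ v
  walk-of-count j u .u h | yes refl = stay
  walk-of-count zero u v h | no u≢v = contradiction (subst (1 ≤_) (δ-≢ u≢v) h) λ ()
  walk-of-count (suc j) u v h | no u≢v with arc-of-count j u v (subst (1 ≤_) (C-≢ j u≢v) h)
  ... | _ , e , w = e ◃ w

  pair-of-count : ∀ j u v → 2 ≤ C j u v → DistinctPair j u v
  pair-of-count zero u v h = contradiction (≤-trans h (δ≤1 u v)) λ { (s≤s ()) }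
  pair-of-count (suc j) u v h with u ≟ v
  pair-of-count (suc j) u .u h | yes refl
    with arc-of-count j u u (≤-pred h)
  ... | _ , e , w = stay , e ◃ w , λ ()
  pair-of-count (suc j) u v h | no u≢v with ∑-two _ h
  ... | inj₁ (x , hx) with indicator-product (G u x) (C j x v) hx
  ...   | e , cx≥2 with pair-of-count j x v cx≥2
  ...     | p , q , p≢q = e ◃ p , e ◃ q , p≢q ∘ ∷-injectiveʳ
  pair-of-count (suc j) u v h | no u≢v | inj₂ (x , y , x≢y , hx , hy)
    with indicator-product (G u x) (C j x v) hx | indicator-product (G u y) (C j y v) hy
  ... | ex , cx≥1 | ey , cy≥1 =
    ex ◃ walk-of-count j x v cx≥1 , ey ◃ walk-of-count j y v cy≥1 , x≢y ∘ ∷-injectiveˡ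

  geodetic-count : ∀ {k} → KGeodetic G k → ∀ {j} → j ≤ k → ∀ u v → C j u v ≤ 1
  geodetic-count geo {j} j≤k u v with C j u v ≤? 1
  ... | yes c≤1 = c≤1
  ... | no c≰1 with pair-of-count j u v (≰⇒> c≰1)
  ...   | (ℓ , ℓ≤j , p) , (m , m≤j , q) , p≢q
    with geo u v ℓ m p q (≤-trans ℓ≤j j≤k) (≤-trans m≤j j≤k)
  ...     | refl , refl = contradiction refl p≢q

  t : ℕ → Fin n → ℕ
  t j v = ∑[ u < n ] C j u v

  t-suc : ∀ j v → t (suc j) v ≡ 1 + ∑[ x < n ] (inDegree x * C j x v)
  t-suc j v = begin
    ∑[ u < n ] (δ u v + ∑[ x < n ] (arc u x * C j x v))
      ≡⟨ ∑-distrib-+ (λ u → δ u v) _ ⟩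
    ∑[ u < n ] δ u v + ∑[ u < n ] ∑[ x < n ] (arc u x * C j x v)
      ≡⟨ cong₂ _+_ (∑-δ-one v) (∑-comm (λ u x → arc u x * C j x v)) ⟩
    1 + ∑[ x < n ] ∑[ u < n ] (arc u x * C j x v)
      ≡⟨ cong (1 +_) (sum-cong-≗ (λ x → sym (*-distribʳ-sum (C j x v) (λ u → arc u x)))) ⟩
    1 + ∑[ x < n ] (inDegree x * C j x v) ∎
    where open ≡-Reasoning

  -- In a k-geodetic digraph the walks of length ≤ k into v start at distinct vertices.
  t-upper : ∀ {k} → KGeodetic G k → ∀ v → t k v ≤ n
  t-upper {k} geo v = subst (t k v ≤_) (∑-one n) (∑-mono-≤ (λ u → geodetic-count geo ≤-refl u v))

-- Growth of the in-ball when in-degrees are ≥ 2 up to one compensated deficit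

∑-weighted : ∀ {n} (d c : Fin n → ℕ) (a b : Fin n) →
  (∀ x → 2 + δ x b ≤ d x + δ x a) →
  2 * sum c + c b ≤ ∑[ x < n ] (d x * c x) + c a
∑-weighted {n} d c a b d-bound = begin
  2 * sum c + c b                          ≡⟨ cong (_+ c b) (*-distribˡ-sum 2 c) ⟩
  ∑[ x < n ] (2 * c x) + c b               ≡⟨ shift (λ _ → 2) b ⟨
  ∑[ x < n ] ((2 + δ x b) * c x)           ≤⟨ ∑-mono-≤ (λ x → *-monoˡ-≤ (c x) (d-bound x)) ⟩
  ∑[ x < n ] ((d x + δ x a) * c x)         ≡⟨ shift d a ⟩
  ∑[ x < n ] (d x * c x) + c a             ∎
  where
  open ≤-Reasoning
  shift : ∀ (w : Fin n → ℕ) y →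
    ∑[ x < n ] ((w x + δ x y) * c x) ≡ ∑[ x < n ] (w x * c x) + c y
  shift w y = trans (sum-cong-≗ (λ x → *-distribʳ-+ (c x) (w x) (δ x y)))
    (trans (∑-distrib-+ (λ x → w x * c x) (λ x → δ x y * c x)) (cong (_ +_) (∑-δ y c)))

module InBallGrowth {n : ℕ} (G : Digraph n) (a b : Fin n)
  (profile : ∀ x → 2 + δ x b ≤ WalkCounts.inDegree G x + δ x a)
  (b-rich : 3 ≤ WalkCounts.inDegree G b) where

  open WalkCounts G

  doubling : ∀ j → C j a b ≤ 1 → 1 + 2 * t j b ≤ t (suc j) b
  doubling j c-ab≤1 = subst (1 + 2 * t j b ≤_) (sym (t-suc j b)) (s≤s twice)
    where
    c : Fin n → ℕ
    c x = C j x b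
    weighted : ℕ
    weighted = ∑[ x < n ] (inDegree x * c x)
    twice : 2 * sum c ≤ weighted
    twice = +-cancelʳ-≤ 1 _ _ (begin
      2 * sum c + 1       ≤⟨ +-monoʳ-≤ (2 * sum c) (C-refl j b) ⟩
      2 * sum c + c b     ≤⟨ ∑-weighted inDegree c a b profile ⟩
      weighted + c a      ≤⟨ +-monoʳ-≤ weighted c-ab≤1 ⟩
      weighted + 1        ∎)
      where open ≤-Reasoning

  t-one : 4 ≤ t 1 b
  t-one = subst (4 ≤_) (sym (t-suc 0 b)) (s≤s (begin
    3                                      ≤⟨ b-rich ⟩
    inDegree b                             ≡⟨ *-identityʳ _ ⟨
    inDegree b * 1                         ≡⟨ cong (inDegree b *_) (δ-refl b) ⟨
    inDegree b * δ b b                     ≤⟨ term≤∑ (λ x → inDegree x * δ x b) b ⟩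
    ∑[ x < n ] (inDegree x * δ x b)        ∎))
    where open ≤-Reasoning

  growth : ∀ {k} → KGeodetic G k → ∀ j → suc j ≤ k → 5 * 2 ^ j ≤ t (suc j) b + 1
  growth geo zero _ = +-monoˡ-≤ 1 t-one
  growth {k} geo (suc j) j+2≤k = begin
    5 * 2 ^ suc j          ≡⟨ solve 1 (λ p → con 5 :* (con 2 :* p) := con 2 :* (con 5 :* p)) refl (2 ^ j) ⟩
    2 * (5 * 2 ^ j)        ≤⟨ *-monoʳ-≤ 2 (growth geo j j+1≤k) ⟩
    2 * (t (suc j) b + 1)  ≡⟨ solve 1 (λ x → con 2 :* (x :+ con 1) := (con 1 :+ con 2 :* x) :+ con 1) refl (t (suc j) b) ⟩
    1 + 2 * t (suc j) b + 1 ≤⟨ +-monoˡ-≤ 1 (doubling (suc j) (geodetic-count geo j+1≤k a b)) ⟩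
    t (suc (suc j)) b + 1  ∎
    where
    open ≤-Reasoning
    open +-*-Solver
    j+1≤k : suc j ≤ k
    j+1≤k = ≤-trans (n≤1+n _) j+2≤k

moore-2 : ∀ k → M 2 k + 1 ≡ 2 ^ suc k
moore-2 zero = refl
moore-2 (suc k) = begin
  M 2 k + 2 ^ suc k + 1   ≡⟨ +-right-comm (M 2 k) _ 1 ⟩
  M 2 k + 1 + 2 ^ suc k   ≡⟨ cong (_+ 2 ^ suc k) (moore-2 k) ⟩
  2 ^ suc k + 2 ^ suc k   ≡⟨ cong (2 ^ suc k +_) (+-identityʳ _) ⟨
  2 ^ suc (suc k)         ∎
  where open ≡-Reasoning

no-room : ∀ p → 4 ≤ p → ¬ (5 * p ≤ 2 * (2 * p) + 2)
no-room p p≥4 h = <⇒≱ (≤-trans (s≤s (s≤s (s≤s z≤n))) p≥4)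
  (+-cancelˡ-≤ (2 * (2 * p)) p 2 (subst (_≤ 2 * (2 * p) + 2) five h))
  where
  open +-*-Solver
  five : 5 * p ≡ 2 * (2 * p) + p
  five = solve 1 (λ p → con 5 :* p := con 2 :* (con 2 :* p) :+ p) refl p

sequence-profile : ∀ {n} (d : Fin n → ℕ) (a b : Fin n) → d a ≡ 1 → d b ≡ 3 →
  (∀ v → ¬ v ≡ a → ¬ v ≡ b → d v ≡ 2) → ∀ x → 2 + δ x b ≤ d x + δ x a
sequence-profile d a b da≡1 db≡3 others x with x ≟ a | x ≟ b
... | yes refl | yes refl = contradiction (trans (sym da≡1) db≡3) λ ()
... | yes refl | no _ = ≤-reflexive (sym (cong (_+ 1) da≡1))
... | no _ | yes refl = ≤-reflexive (sym (trans (+-identityʳ (d b)) db≡3))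
... | no x≢a | no x≢b = ≤-reflexive (sym (trans (+-identityʳ (d x)) (others x x≢a x≢b)))

theorem4 : (k : ℕ) → 3 ≤ k → (G : Digraph (M 2 k + 2)) →
    KGeodetic G k → MinOutDegAtLeast G 2 → InDegSeq1-2-3 G → ⊥
theorem4 k@(suc j@(suc (suc i))) _ G geo _ (a , b , ha , hb , hr) =
  no-room (2 ^ j) (*-monoʳ-≤ 2 (*-monoʳ-≤ 2 (m^n>0 2 i))) (begin
    5 * 2 ^ j            ≤⟨ growth geo j ≤-refl ⟩
    t k b + 1            ≤⟨ +-monoˡ-≤ 1 (t-upper geo b) ⟩
    M 2 k + 2 + 1        ≡⟨ +-right-comm (M 2 k) 2 1 ⟩
    M 2 k + 1 + 2        ≡⟨ cong (_+ 2) (moore-2 k) ⟩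
    2 * (2 * 2 ^ j) + 2  ∎)
  where
  open ≤-Reasoning
  open WalkCounts G
  fromIndeg : ∀ {x m} → indeg G x ≡ m → inDegree x ≡ m
  fromIndeg = trans (sym (inDegree-≡ _))
  profile : ∀ x → 2 + δ x b ≤ inDegree x + δ x a
  profile = sequence-profile inDegree a b (fromIndeg ha) (fromIndeg hb)
    (λ v v≢a v≢b → fromIndeg (hr v v≢a v≢b))
  open InBallGrowth G a b profile (≤-reflexive (sym (fromIndeg hb)))
theorem4 (suc zero) (s≤s ()) _ _ _ _
theorem4 (suc (suc zero)) (s≤s (s≤s ())) _ _ _ _
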